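{- Let $n>3$, let $f$ and $f'$ be quadratic crooked functions over $\mathbb F_{2^n}$, let $\sigma$ be a permutation of $\mathbb F_{2^n}$ with $\sigma(0)=0$, and let $\kappa$ be a collineation of $\mathrm{PG}(n,2)$ (an invertible $\mathbb F_2$-linear map of $\mathbb F_{2^n}\times\mathbb F_2$) such that $\sigma(c_f(u,v))=c_{f'}(\kappa(u),\kappa(v))$ for all $u,v\in\mathbb F_{2^n}\times\mathbb F_2$. Then $\kappa(\mathcal H)=\mathcal H$, where $\mathcal H=\{(x,0):x\in\mathbb F_{2^n}\}$.
   Context: A function $f:\mathbb F_{2^n}\to\mathbb F_{2^n}$ is crooked if $f(0)=0$, $f(x)+f(y)+f(z)+f(x+y+z)\neq0$ for any three distinct $x,y,z$, and $f(x)+f(y)+f(z)+f(x+a)+f(y+a)+f(z+a)\neq0$ for any $a\neq0$ and any $x,y,z$. $f$ is quadratic if it is a polynomial over $\mathbb F_{2^n}$ whose monomials $x^d$ all have $d$ of binary weight at most $2$. $\mathrm{PG}(n,2)$ is identified with the nonzero vectors of $\mathbb F_{2^n}\times\mathbb F_2$. $c_f((x,x_1),(y,y_1))=f(x+y)+f(x)+f(y)+f(x_1y+y_1x)$. -}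

module Defs where

open import Level using (0ℓ)
open import Data.Nat as ℕ using (ℕ; zero; suc; _≤_)
open import Data.Nat.DivMod using (_%_; _/_)
open import Data.Fin using (Fin)
open import Data.Bool using (Bool; true; false)
open import Data.Product using (_×_; _,_; proj₁; proj₂; ∃)
open import Data.List using (List; []; _∷_)
open import Data.List.Relation.Unary.All using (All)
open import Relation.Binary.PropositionalEquality using (_≡_)
open import Relation.Nullary using (¬_)
open import Algebra.Structures using (IsCommutativeRing)
open import Function.Bundles using (_↔_)
open import Function.Definitions using (Bijective)

-- binary weight (number of 1 bits) of a natural number;
-- the fuel argument d suffices since the number halves at each step
bitsWithFuel : ℕ → ℕ → ℕ
bitsWithFuel zero    m = 0
bitsWithFuel (suc k) m = m % 2 ℕ.+ bitsWithFuel k (m / 2)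

binaryWeight : ℕ → ℕ
binaryWeight d = bitsWithFuel d d

record GF2^ (n : ℕ) : Set₁ where
  infixl 7 _*_
  infixl 6 _+_
  field
    Carrier : Set
    _+_ _*_ : Carrier → Carrier → Carrier
    -_      : Carrier → Carrier
    0# 1#   : Carrier
    isCommutativeRing : IsCommutativeRing _≡_ _+_ _*_ -_ 0# 1#
    0≢1     : ¬ (0# ≡ 1#)
    inverse : ∀ x → ¬ (x ≡ 0#) → ∃ λ y → x * y ≡ 1#
    card    : Carrier ↔ Fin (2 ℕ.^ n)

  _^_ : Carrier → ℕ → Carrier
  x ^ zero  = 1#
  x ^ suc d = x * (x ^ d)

  _·_ : Bool → Carrier → Carrier
  true  · y = y
  false · y = 0#

  record Crooked (f : Carrier → Carrier) : Set where
    field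
      f0 : f 0# ≡ 0#
      three : ∀ x y z → ¬ (x ≡ y) → ¬ (x ≡ z) → ¬ (y ≡ z) →
              ¬ (f x + f y + f z + f (x + y + z) ≡ 0#)
      six : ∀ a → ¬ (a ≡ 0#) → ∀ x y z →
            ¬ (f x + f y + f z + f (x + a) + f (y + a) + f (z + a) ≡ 0#)

  evalPoly : List (Carrier × ℕ) → Carrier → Carrier
  evalPoly []             x = 0#
  evalPoly ((c , d) ∷ ms) x = c * (x ^ d) + evalPoly ms x

  Quadratic : (Carrier → Carrier) → Set
  Quadratic f = ∃ λ (p : List (Carrier × ℕ)) →
                  All (λ m → binaryWeight (proj₂ m) ≤ 2) p × (∀ x → f x ≡ evalPoly p x)

  V : Set
  V = Carrier × Bool

  _⊕_ : V → V → V
  (x , x₁) ⊕ (y , y₁) = (x + y , x₁ Data.Bool.xor y₁)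

  -- collineation of PG(n,2): invertible F_2-linear (= additive) map of V
  record Collineation (κ : V → V) : Set where
    field
      additive  : ∀ u v → κ (u ⊕ v) ≡ κ u ⊕ κ v
      bijective : Bijective _≡_ _≡_ κ

  c : (Carrier → Carrier) → V → V → Carrier
  c f (x , x₁) (y , y₁) = f (x + y) + f x + f y + f ((x₁ · y) + (y₁ · x))

  InH : V → Set
  InH u = proj₂ u ≡ false

module Submission where

open import Defs
open import Data.Nat using (ℕ; _<_)
open import Data.Bool using (false)
open import Data.Product using (_×_; _,_; ∃)
open import Relation.Binary.PropositionalEquality using (_≡_)
open import Function.Definitions using (Bijective)

-- Since the third derivative of a quadratic function vanishes, c_f(u, ·) is additive for u ∈ H,
-- while crookedness makes c_f((x,1), ·) non-additive and gives c_f((s,0), ·) the kernel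
-- {0, (s,0)}, hence makes it onto F for s ≠ 0.  Choosing s ≠ 0 with κ(s,0) ∈ H, the
-- isomorphism transports additivity of c_f((s,0), ·) to σ.
-- With σ additive, c_f'(κ u, ·) is additive for every u ∈ H, so κ u ∈ H.  The reverse
-- inclusion is the same argument for the inverse isomorphism (σ⁻¹, κ⁻¹).

module InvolutionParity where
  open import Data.Bool.Base using (if_then_else_)
  open import Data.Fin.Base using (Fin; zero; suc)
  open import Data.Fin.Properties using (_≟_; _<?_; <-cmp)
  open import Data.Fin.Permutation using (permutation)
  open import Data.Nat.Base using (zero; suc; _^_; parity; NonZero)
  open import Function.Bundles using (mk⇔)
  open import Data.Parity.Base as ℙ using (Parity; 0ℙ; 1ℙ)
  import Data.Parity.Properties as ℙ
  open import Algebra.Properties.CommutativeMonoid.Sum ℙ.+-0-commutativeMonoid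
    using (sum-syntax; sum-cong-≗; ∑-distrib-+; ∑-permute; sum-replicate-zero)
  open import Data.Product.Base using (proj₁)
  open import Function.Base using (_∘_)
  open import Relation.Nullary using (Dec; does; ¬_)
  open import Relation.Nullary.Decidable using (dec-true; dec-false; does-⇔)
  open import Relation.Binary.Definitions using (tri<; tri≈; tri>)
  open import Relation.Binary.PropositionalEquality
    using (refl; sym; trans; cong; module ≡-Reasoning)

  private variable m : ℕ

  ⟦_⟧ : {A : Set} → Dec A → Parity
  ⟦ a? ⟧ = if does a? then 1ℙ else 0ℙ

  ⟦⟧-yes : {A : Set} (a? : Dec A) → A → ⟦ a? ⟧ ≡ 1ℙ
  ⟦⟧-yes a? a rewrite dec-true a? a = refl

  ⟦⟧-no : {A : Set} (a? : Dec A) → ¬ A → ⟦ a? ⟧ ≡ 0ℙ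
  ⟦⟧-no a? ¬a rewrite dec-false a? ¬a = refl

  ⟦<⟧+⟦>⟧+⟦≡⟧ : (i j : Fin m) → ⟦ i <? j ⟧ ℙ.+ ⟦ j <? i ⟧ ℙ.+ ⟦ j ≟ i ⟧ ≡ 1ℙ
  ⟦<⟧+⟦>⟧+⟦≡⟧ i j with <-cmp i j
  ... | tri< i<j i≢j j≮i
    rewrite ⟦⟧-yes (i <? j) i<j | ⟦⟧-no (j <? i) j≮i | ⟦⟧-no (j ≟ i) (i≢j ∘ sym) = refl
  ... | tri≈ i≮i refl _
    rewrite ⟦⟧-no (i <? i) i≮i | ⟦⟧-yes (i ≟ i) refl = refl
  ... | tri> i≮j i≢j j<i
    rewrite ⟦⟧-no (i <? j) i≮j | ⟦⟧-yes (j <? i) j<i | ⟦⟧-no (j ≟ i) (i≢j ∘ sym) = refl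

  ∑-1ℙ : ∑[ i < m ] 1ℙ ≡ parity m
  ∑-1ℙ {zero}  = refl
  ∑-1ℙ {suc m} = trans (cong (1ℙ ℙ.+_) (∑-1ℙ {m})) (sym (ℙ.+-homo-+ 1 m))

  ∑-⟦≟⟧ : (j : Fin m) → ∑[ i < m ] ⟦ i ≟ j ⟧ ≡ 1ℙ
  ∑-⟦≟⟧ {suc m} zero    = cong (1ℙ ℙ.+_) (sum-replicate-zero m)
  ∑-⟦≟⟧ {suc m} (suc j) = ∑-⟦≟⟧ j

  ⟦⟧-⇔ : {A B : Set} → (A → B) → (B → A) → (a? : Dec A) (b? : Dec B) → ⟦ a? ⟧ ≡ ⟦ b? ⟧
  ⟦⟧-⇔ A→B B→A a? b? = cong (if_then 1ℙ else 0ℙ) (does-⇔ (mk⇔ A→B B→A) a? b?)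

  parity-2^ : ∀ n → .{{NonZero n}} → parity (2 ^ n) ≡ 0ℙ
  parity-2^ (suc k) = ℙ.*-homo-* 2 (2 ^ k)

  -- Each i lies below, above or at τ i; reindexing by τ matches "below" with "above".
  involution-parity : (τ : Fin m → Fin m) → (∀ i → τ (τ i) ≡ i) →
                      parity m ≡ ∑[ i < m ] ⟦ τ i ≟ i ⟧
  involution-parity {m} τ τ∘τ≗id = begin
    parity m                                                  ≡⟨ sym (∑-1ℙ {m}) ⟩
    ∑[ i < m ] 1ℙ                                             ≡⟨ sum-cong-≗ (λ i → sym (⟦<⟧+⟦>⟧+⟦≡⟧ i (τ i))) ⟩
    ∑[ i < m ] (below i ℙ.+ above i ℙ.+ fixed i)              ≡⟨ ∑-distrib-+ (λ i → below i ℙ.+ above i) fixed ⟩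
    ∑[ i < m ] (below i ℙ.+ above i) ℙ.+ ∑[ i < m ] fixed i   ≡⟨ cong (ℙ._+ ∑fixed) (∑-distrib-+ below above) ⟩
    ∑below ℙ.+ ∑[ i < m ] above i ℙ.+ ∑fixed                  ≡⟨ cong (λ p → ∑below ℙ.+ p ℙ.+ ∑fixed) ∑above≡∑below ⟩
    ∑below ℙ.+ ∑below ℙ.+ ∑fixed                              ≡⟨ cong (ℙ._+ ∑fixed) (proj₁ ℙ.+-inverse ∑below) ⟩
    ∑fixed                                                    ∎
    where
    open ≡-Reasoning
    below above fixed : Fin m → Parity
    below i = ⟦ i <? τ i ⟧
    above i = ⟦ τ i <? i ⟧
    fixed i = ⟦ τ i ≟ i ⟧
    ∑below ∑fixed : Parity
    ∑below = ∑[ i < m ] below i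
    ∑fixed = ∑[ i < m ] fixed i
    ∑above≡∑below : ∑[ i < m ] above i ≡ ∑below
    ∑above≡∑below = trans (∑-permute above (permutation τ τ τ∘τ≗id τ∘τ≗id))
                          (sum-cong-≗ λ i → cong (λ k → ⟦ k <? τ i ⟧) (τ∘τ≗id i))

module FiniteType where
  open import Data.Bool.Base using (Bool)
  open import Data.Empty using (⊥-elim)
  open import Data.Fin.Base using (Fin; zero; suc; punchIn; punchOut)
  open import Data.Fin.Properties as Fin
    using (_<?_; <-cmp; any?; punchInᵢ≢i; punchIn-injective; punchIn-punchOut;
           punchOut-injective; injective⇒≤; inj⇒≟)
  open import Data.Nat.Base using (suc; s≤s)
  open import Data.Nat.Properties using (1+n≰n)
  open import Function.Base using (_∘_)
  open import Function.Bundles using (_↔_; Inverse)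
  open import Function.Definitions using (Injective; StrictlySurjective)
  open import Function.Properties.Inverse using (↔⇒↣)
  open import Relation.Binary.Definitions using (DecidableEquality; tri<; tri≈; tri>)
  open import Relation.Binary.PropositionalEquality
    using (_≢_; refl; sym; trans; cong)
  open import Relation.Nullary using (does; yes; no; contradiction)
  open import Relation.Nullary.Decidable using (dec-true; dec-false)

  private variable m : ℕ

  Fin-∃≢₂ : 2 < m → (a b : Fin m) → ∃ λ c → c ≢ a × c ≢ b
  Fin-∃≢₂ (s≤s (s≤s (s≤s _))) a b with a Fin.≟ b
  ... | yes refl = punchIn a zero , punchInᵢ≢i a zero , punchInᵢ≢i a zero
  ... | no a≢b   = punchIn a c , punchInᵢ≢i a c , punchIn-a-c≢b
    where
    b′ = punchOut a≢b
    c = punchIn b′ zero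
    punchIn-a-c≢b : punchIn a c ≢ b
    punchIn-a-c≢b eq = punchInᵢ≢i b′ zero (punchIn-injective a c b′ (trans eq (sym (punchIn-punchOut a≢b))))

  Fin-injective⇒surjective : (h : Fin m → Fin m) → Injective _≡_ _≡_ h → StrictlySurjective _≡_ h
  Fin-injective⇒surjective {suc m} h h-injective t with any? (λ i → h i Fin.≟ t)
  ... | yes hit = hit
  ... | no miss = contradiction (injective⇒≤ punchOut∘h-injective) 1+n≰n
    where
    t≢h : ∀ i → t ≢ h i
    t≢h i = miss ∘ (i ,_) ∘ sym
    punchOut∘h-injective : Injective _≡_ _≡_ (λ i → punchOut (t≢h i))
    punchOut∘h-injective eq = h-injective (punchOut-injective (t≢h _) (t≢h _) eq)

  does-<?-flip : {i j : Fin m} → i ≢ j → does (i <? j) ≢ does (j <? i)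
  does-<?-flip {i = i} {j} i≢j with <-cmp i j
  ... | tri< i<j _ j≮i rewrite dec-true (i <? j) i<j | dec-false (j <? i) j≮i = λ ()
  ... | tri≈ _ i≡j _   = ⊥-elim (i≢j i≡j)
  ... | tri> i≮j _ j<i rewrite dec-false (i <? j) i≮j | dec-true (j <? i) j<i = λ ()

  module Enumerated {A : Set} (A↔Fin : A ↔ Fin m) where
    open Inverse A↔Fin using (to; from; strictlyInverseˡ; strictlyInverseʳ)

    _≟_ : DecidableEquality A
    _≟_ = inj⇒≟ (↔⇒↣ A↔Fin)

    to-injective : Injective _≡_ _≡_ to
    to-injective {x} {y} eq = trans (sym (strictlyInverseʳ x)) (trans (cong from eq) (strictlyInverseʳ y))

    injective⇒surjective : (g : A → A) → Injective _≡_ _≡_ g → StrictlySurjective _≡_ g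
    injective⇒surjective g g-injective t =
      let i , hi≡t = Fin-injective⇒surjective (to ∘ g ∘ from) h-injective (to t)
      in  from i , to-injective hi≡t
      where
      h-injective : Injective _≡_ _≡_ (to ∘ g ∘ from)
      h-injective eq = trans (sym (strictlyInverseˡ _)) (trans (cong to (g-injective (to-injective eq))) (strictlyInverseˡ _))

    ∃≢₂ : 2 < m → (a b : A) → ∃ λ c → c ≢ a × c ≢ b
    ∃≢₂ 2<m a b with Fin-∃≢₂ 2<m (to a) (to b)
    ... | i , i≢a , i≢b = from i , i≢a ∘ lift , i≢b ∘ lift
      where
      lift : ∀ {x} → from i ≡ x → i ≡ to x
      lift eq = trans (sym (strictlyInverseˡ i)) (cong to eq)

    involution-orientation : (ι : A → A) → (∀ y → ι (ι y) ≡ y) → (∀ y → ι y ≢ y) →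
                             ∃ λ (χ : A → Bool) → ∀ y → χ (ι y) ≢ χ y
    involution-orientation ι ι∘ι≗id ι-fixedPointFree = χ , χ∘ι≢χ
      where
      χ : A → Bool
      χ y = does (to y <? to (ι y))
      χ∘ι≢χ : ∀ y → χ (ι y) ≢ χ y
      χ∘ι≢χ y = does-<?-flip (ι-fixedPointFree y ∘ to-injective)
              ∘ trans (cong (λ k → does (to (ι y) <? to k)) (sym (ι∘ι≗id y)))

module BinaryWeight where
  open import Data.Nat.Base using (zero; suc; _+_; _*_; _^_; _≤_; z≤n; s≤s)
  open import Data.Nat.DivMod using (_%_; _/_; m≡m%n+[m/n]*n; m%n<n; m/n<m)
  open import Data.Nat.Properties
    using (n≤0⇒n≡0; ≤-pred; ≤-trans; ≤-refl; *-comm; *-distribʳ-+; +-comm)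
  open import Data.Sum.Base using (_⊎_; inj₁; inj₂)
  open import Relation.Binary.PropositionalEquality
    using (refl; sym; trans; cong; subst)

  infixr 5 _∷_
  data PowerOfTwoSum : ℕ → ℕ → Set where
    []  : ∀ {w} → PowerOfTwoSum w 0
    _∷_ : ∀ {w d} i → PowerOfTwoSum w d → PowerOfTwoSum (suc w) (d + 2 ^ i)

  double : ∀ {w d} → PowerOfTwoSum w d → PowerOfTwoSum w (d * 2)
  double []                  = []
  double (_∷_ {d = d} i ds) = subst (PowerOfTwoSum _) (sym (trans (*-distribʳ-+ 2 d (2 ^ i))
                                (cong (d * 2 +_) (*-comm (2 ^ i) 2)))) (suc i ∷ double ds)

  %2-cases : ∀ d → d % 2 ≡ 0 ⊎ d % 2 ≡ 1
  %2-cases d with d % 2 | m%n<n d 2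
  ... | 0           | _               = inj₁ refl
  ... | 1           | _               = inj₂ refl
  ... | suc (suc _) | s≤s (s≤s ())

  /2≤ : ∀ {d k} → d ≤ suc k → d / 2 ≤ k
  /2≤ {zero}  _     = z≤n
  /2≤ {suc d} d≤1+k = ≤-pred (≤-trans (m/n<m (suc d) 2 (s≤s (s≤s z≤n))) d≤1+k)

  bitsWithFuel⇒PowerOfTwoSum : ∀ k {d w} → d ≤ k → bitsWithFuel k d ≤ w → PowerOfTwoSum w d
  bitsWithFuel⇒PowerOfTwoSum zero    d≤0 _ rewrite n≤0⇒n≡0 d≤0 = []
  bitsWithFuel⇒PowerOfTwoSum (suc k) {d} d≤1+k bits≤w with %2-cases d
  ... | inj₁ d%2≡0 rewrite d%2≡0 =
    subst (PowerOfTwoSum _) (sym (trans (m≡m%n+[m/n]*n d 2) (cong (_+ d / 2 * 2) d%2≡0)))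
          (double (bitsWithFuel⇒PowerOfTwoSum k (/2≤ d≤1+k) bits≤w))
  ... | inj₂ d%2≡1 rewrite d%2≡1 with bits≤w
  ...   | s≤s bits′≤w = subst (PowerOfTwoSum _) d≡
          (0 ∷ double (bitsWithFuel⇒PowerOfTwoSum k (/2≤ d≤1+k) bits′≤w))
    where
    d≡ : d / 2 * 2 + 1 ≡ d
    d≡ = sym (trans (m≡m%n+[m/n]*n d 2) (trans (cong (_+ d / 2 * 2) d%2≡1) (+-comm 1 _)))

  binaryWeight⇒PowerOfTwoSum : ∀ {d w} → binaryWeight d ≤ w → PowerOfTwoSum w d
  binaryWeight⇒PowerOfTwoSum {d} = bitsWithFuel⇒PowerOfTwoSum d ≤-refl

module Field {n : ℕ} (F : GF2^ n) where
  open import Algebra.Bundles using (CommutativeRing; RawRing)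
  open import Algebra.Solver.Ring.AlmostCommutativeRing
    using (AlmostCommutativeRing; fromCommutativeRing; _-Raw-AlmostCommutative⟶_)
  open import Algebra.Structures using (IsCommutativeRing)
  open import Data.Bool.Base using (Bool; true; false; _∧_; _xor_)
  open import Data.Empty using (⊥-elim)
  open import Data.Fin.Base using (Fin)
  import Data.Fin.Properties as Fin
  open import Data.List.Base using ([]; _∷_)
  open import Data.List.Relation.Unary.All using (All; []; _∷_)
  open import Data.Maybe.Base using (Maybe; just; nothing)
  open import Data.Nat.Base as ℕ using (NonZero; parity)
  import Data.Nat.Properties as ℕₚ
  open import Data.Parity.Base using (0ℙ; 1ℙ)
  import Data.Parity.Properties as ℙ
  open import Algebra.Properties.CommutativeMonoid.Sum ℙ.+-0-commutativeMonoid
    using (sum-syntax; sum-cong-≗)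
  open import Data.Product.Base using (proj₁; proj₂)
  open import Data.Sum.Base using (_⊎_; inj₁; inj₂)
  open import Function.Base using (_∘_)
  open import Function.Definitions using (Injective)
  open import Function.Bundles using (_↔_; Inverse; Bijection; mk⤖)
  open import Function.Construct.Symmetry using (↔-sym)
  open import Function.Properties.Bijection using (⤖⇒↔)
  open import Function.Properties.Inverse using (↔⇒⤖)
  open import Relation.Binary.PropositionalEquality
    using (_≢_; refl; sym; trans; cong; cong₂; module ≡-Reasoning)
  open import Relation.Nullary using (yes; no)

  open GF2^ F
  open IsCommutativeRing isCommutativeRing
    using (+-comm; +-identityˡ; +-identityʳ; *-identityˡ; zeroˡ; zeroʳ; distribʳ; *-assoc; *-comm; -‿inverseʳ)
  open FiniteType.Enumerated card
  open InvolutionParity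
  open BinaryWeight

  ring : CommutativeRing _ _
  ring = record { isCommutativeRing = isCommutativeRing }

  open import Algebra.Properties.Ring (CommutativeRing.ring ring)
    using (-0#≈0#; -‿involutive; +-cancelˡ; +-inverseʳ-unique)
  open Inverse card using (to; from; strictlyInverseˡ; strictlyInverseʳ)

  x≡-x⇒x≡0 : 1# + 1# ≢ 0# → ∀ {x} → x ≡ - x → x ≡ 0#
  x≡-x⇒x≡0 2≢0 {x} x≡-x = begin
    x                     ≡⟨ sym (*-identityˡ x) ⟩
    1# * x                ≡⟨ cong (_* x) (sym ½*2≡1) ⟩
    (½ * (1# + 1#)) * x   ≡⟨ *-assoc ½ _ x ⟩
    ½ * ((1# + 1#) * x)   ≡⟨ cong (½ *_) 2x≡0 ⟩
    ½ * 0#                ≡⟨ zeroʳ ½ ⟩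
    0#                    ∎
    where
    open ≡-Reasoning
    ½ = proj₁ (inverse (1# + 1#) 2≢0)
    ½*2≡1 : ½ * (1# + 1#) ≡ 1#
    ½*2≡1 = trans (*-comm ½ _) (proj₂ (inverse (1# + 1#) 2≢0))
    2x≡0 : (1# + 1#) * x ≡ 0#
    2x≡0 = begin
      (1# + 1#) * x    ≡⟨ distribʳ x 1# 1# ⟩
      1# * x + 1# * x  ≡⟨ cong₂ _+_ (*-identityˡ x) (trans (*-identityˡ x) x≡-x) ⟩
      x + - x          ≡⟨ -‿inverseʳ x ⟩
      0#               ∎

  -- Otherwise negation would be an involution of the 2^n elements with the single fixed point 0.
  characteristic-two : .{{NonZero n}} → 1# + 1# ≡ 0#
  characteristic-two with (1# + 1#) ≟ 0#
  ... | yes 2≡0 = 2≡0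
  ... | no 2≢0  = ⊥-elim (0ℙ≢1ℙ (begin
    0ℙ                                   ≡⟨ sym (parity-2^ n) ⟩
    parity (2 ℕ.^ n)                     ≡⟨ involution-parity τ τ∘τ≗id ⟩
    ∑[ i < 2 ℕ.^ n ] ⟦ τ i Fin.≟ i ⟧     ≡⟨ sum-cong-≗ fixed⇔zero ⟩
    ∑[ i < 2 ℕ.^ n ] ⟦ i Fin.≟ to 0# ⟧   ≡⟨ ∑-⟦≟⟧ (to 0#) ⟩
    1ℙ                                   ∎))
    where
    open ≡-Reasoning
    0ℙ≢1ℙ : 0ℙ ≢ 1ℙ
    0ℙ≢1ℙ ()
    τ : Fin (2 ℕ.^ n) → Fin (2 ℕ.^ n)
    τ i = to (- from i)
    τ∘τ≗id : ∀ i → τ (τ i) ≡ i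
    τ∘τ≗id i = trans (cong (to ∘ -_) (strictlyInverseʳ _))
                     (trans (cong to (-‿involutive _)) (strictlyInverseˡ i))
    fixed⇒zero : ∀ i → τ i ≡ i → i ≡ to 0#
    fixed⇒zero i τi≡i = trans (sym (strictlyInverseˡ i)) (cong to (x≡-x⇒x≡0 2≢0 (sym -fromi≡fromi)))
      where
      -fromi≡fromi : - from i ≡ from i
      -fromi≡fromi = trans (sym (strictlyInverseʳ _)) (cong from τi≡i)
    zero⇒fixed : ∀ i → i ≡ to 0# → τ i ≡ i
    zero⇒fixed _ refl = trans (cong (to ∘ -_) (strictlyInverseʳ 0#)) (cong to -0#≈0#)
    fixed⇔zero : ∀ i → ⟦ τ i Fin.≟ i ⟧ ≡ ⟦ i Fin.≟ to 0# ⟧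
    fixed⇔zero i = ⟦⟧-⇔ (fixed⇒zero i) (zero⇒fixed i) (τ i Fin.≟ i) (i Fin.≟ to 0#)

  module Characteristic2 (1+1≡0 : 1# + 1# ≡ 0#) where

    -- The ring solver is run with coefficients in 𝔽₂ = Bool, so that it knows 1 + 1 = 0.
    𝔽₂ : RawRing _ _
    𝔽₂ = record
      { Carrier = Bool ; _≈_ = _≡_ ; _+_ = _xor_ ; _*_ = _∧_ ; -_ = λ b → b ; 0# = false ; 1# = true }

    embed : Bool → Carrier
    embed true  = 1#
    embed false = 0#

    embed-homomorphism : 𝔽₂ -Raw-AlmostCommutative⟶ fromCommutativeRing ring
    embed-homomorphism = record
      { ⟦_⟧    = embed
      ; +-homo = λ { true true → sym 1+1≡0 ; true false → sym (+-identityʳ 1#)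
                   ; false true → sym (+-identityˡ 1#) ; false false → sym (+-identityˡ 0#) }
      ; *-homo = λ { true true → sym (*-identityˡ 1#) ; true false → sym (zeroʳ 1#)
                   ; false true → sym (zeroˡ 1#) ; false false → sym (zeroˡ 0#) }
      ; -‿homo = λ { true → +-inverseʳ-unique 1# 1# 1+1≡0 ; false → sym -0#≈0# }
      ; 0-homo = refl
      ; 1-homo = refl
      }

    embed-≟ : ∀ a b → Maybe (embed a ≡ embed b)
    embed-≟ true  true  = just refl
    embed-≟ false false = just refl
    embed-≟ _     _     = nothing

    open import Algebra.Solver.Ring 𝔽₂ (fromCommutativeRing ring) embed-homomorphism embed-≟
      using (solve; _:=_; _:+_; _:*_; con)

    x+x≡0 : ∀ x → x + x ≡ 0#
    x+x≡0 = solve 1 (λ x → x :+ x := con false) refl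

    x+[x+y]≡y : ∀ x y → x + (x + y) ≡ y
    x+[x+y]≡y = solve 2 (λ x y → x :+ (x :+ y) := y) refl

    +≡0⇒≡ : ∀ {x y} → x + y ≡ 0# → x ≡ y
    +≡0⇒≡ {x} {y} x+y≡0 = sym (trans (sym (x+[x+y]≡y x y)) (trans (cong (x +_) x+y≡0) (+-identityʳ x)))

    ≡⇒+≡0 : ∀ {x y} → x ≡ y → x + y ≡ 0#
    ≡⇒+≡0 {x} refl = x+x≡0 x

    ^-+ : ∀ x a b → x ^ (a ℕ.+ b) ≡ x ^ a * x ^ b
    ^-+ x ℕ.zero    b = sym (*-identityˡ _)
    ^-+ x (ℕ.suc a) b = trans (cong (x *_) (^-+ x a b)) (sym (*-assoc _ _ _))

    ^-2^suc : ∀ i x → x ^ (2 ℕ.^ ℕ.suc i) ≡ x ^ (2 ℕ.^ i) * x ^ (2 ℕ.^ i)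
    ^-2^suc i x = trans (cong (λ k → x ^ (2 ℕ.^ i ℕ.+ k)) (ℕₚ.+-identityʳ (2 ℕ.^ i))) (^-+ x (2 ℕ.^ i) (2 ℕ.^ i))

    frobenius-+ : ∀ i x y → (x + y) ^ (2 ℕ.^ i) ≡ x ^ (2 ℕ.^ i) + y ^ (2 ℕ.^ i)
    frobenius-+ ℕ.zero = solve 2 (λ x y → (x :+ y) :* con true := x :* con true :+ y :* con true) refl
    frobenius-+ (ℕ.suc i) x y = begin
      (x + y) ^ (2 ℕ.^ ℕ.suc i)                    ≡⟨ ^-2^suc i (x + y) ⟩
      (x + y) ^ (2 ℕ.^ i) * (x + y) ^ (2 ℕ.^ i)    ≡⟨ cong₂ _*_ (frobenius-+ i x y) (frobenius-+ i x y) ⟩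
      (xᵏ + yᵏ) * (xᵏ + yᵏ)                         ≡⟨ solve 2 (λ a b → (a :+ b) :* (a :+ b) := a :* a :+ b :* b) refl xᵏ yᵏ ⟩
      xᵏ * xᵏ + yᵏ * yᵏ                             ≡⟨ sym (cong₂ _+_ (^-2^suc i x) (^-2^suc i y)) ⟩
      x ^ (2 ℕ.^ ℕ.suc i) + y ^ (2 ℕ.^ ℕ.suc i)    ∎
      where
      open ≡-Reasoning
      xᵏ = x ^ (2 ℕ.^ i)
      yᵏ = y ^ (2 ℕ.^ i)

    Affine : (Carrier → Carrier) → Set
    Affine g = ∀ x y → g (x + y) ≡ g x + g y + g 0#

    const-affine : ∀ k → Affine (λ _ → k)
    const-affine k _ _ = solve 1 (λ k → k := k :+ k :+ k) refl k

    additive⇒affine : ∀ {g} → (∀ x y → g (x + y) ≡ g x + g y) → Affine g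
    additive⇒affine {g} g-additive x y =
      trans (g-additive x y) (sym (trans (cong (g x + g y +_) g0≡0) (+-identityʳ _)))
      where
      g0≡0 : g 0# ≡ 0#
      g0≡0 = trans (cong g (sym (+-identityʳ 0#))) (trans (g-additive 0# 0#) (x+x≡0 (g 0#)))

    *-affine : ∀ c {g} → Affine g → Affine (λ t → c * g t)
    *-affine c {g} g-affine x y = trans (cong (c *_) (g-affine x y))
      (solve 4 (λ c a b e → c :* (a :+ b :+ e) := c :* a :+ c :* b :+ c :* e) refl c (g x) (g y) (g 0#))

    ^-affine : ∀ {d} → PowerOfTwoSum 1 d → Affine (_^ d)
    ^-affine []       = const-affine 1#
    ^-affine (i ∷ []) = additive⇒affine (frobenius-+ i)

    -- Δ³ g x y z is the third derivative D_x D_y D_z g at 0.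
    Δ³ : (Carrier → Carrier) → Carrier → Carrier → Carrier → Carrier
    Δ³ g x y z = g (x + (y + z)) + g (x + y) + g (x + z) + g (y + z) + g x + g y + g z + g 0#

    Δ³-cong : ∀ {g h} → (∀ t → g t ≡ h t) → ∀ x y z → Δ³ g x y z ≡ Δ³ h x y z
    Δ³-cong g≗h x y z
      rewrite g≗h (x + (y + z)) | g≗h (x + y) | g≗h (x + z) | g≗h (y + z)
            | g≗h x | g≗h y | g≗h z | g≗h 0# = refl

    Δ³-const : ∀ k x y z → Δ³ (λ _ → k) x y z ≡ 0#
    Δ³-const k _ _ _ = solve 1 (λ k → k :+ k :+ k :+ k :+ k :+ k :+ k :+ k := con false) refl k

    Δ³-+ : ∀ g h x y z → Δ³ (λ t → g t + h t) x y z ≡ Δ³ g x y z + Δ³ h x y z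
    Δ³-+ g h x y z = solve 16 (λ a₁ a₂ a₃ a₄ a₅ a₆ a₇ a₈ b₁ b₂ b₃ b₄ b₅ b₆ b₇ b₈ →
        (a₁ :+ b₁) :+ (a₂ :+ b₂) :+ (a₃ :+ b₃) :+ (a₄ :+ b₄) :+ (a₅ :+ b₅) :+ (a₆ :+ b₆) :+ (a₇ :+ b₇) :+ (a₈ :+ b₈)
        := (a₁ :+ a₂ :+ a₃ :+ a₄ :+ a₅ :+ a₆ :+ a₇ :+ a₈) :+ (b₁ :+ b₂ :+ b₃ :+ b₄ :+ b₅ :+ b₆ :+ b₇ :+ b₈)) refl
      (g (x + (y + z))) (g (x + y)) (g (x + z)) (g (y + z)) (g x) (g y) (g z) (g 0#)
      (h (x + (y + z))) (h (x + y)) (h (x + z)) (h (y + z)) (h x) (h y) (h z) (h 0#)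

    Δ³-product : ∀ {B D} → Affine B → Affine D → ∀ x y z → Δ³ (λ t → B t * D t) x y z ≡ 0#
    Δ³-product {B} {D} B-affine D-affine x y z
      rewrite B-affine x (y + z) | B-affine y z | B-affine x y | B-affine x z
            | D-affine x (y + z) | D-affine y z | D-affine x y | D-affine x z =
      solve 8 (λ b₁ b₂ b₃ b₀ d₁ d₂ d₃ d₀ →
          (b₁ :+ (b₂ :+ b₃ :+ b₀) :+ b₀) :* (d₁ :+ (d₂ :+ d₃ :+ d₀) :+ d₀)
          :+ (b₁ :+ b₂ :+ b₀) :* (d₁ :+ d₂ :+ d₀) :+ (b₁ :+ b₃ :+ b₀) :* (d₁ :+ d₃ :+ d₀)
          :+ (b₂ :+ b₃ :+ b₀) :* (d₂ :+ d₃ :+ d₀) :+ b₁ :* d₁ :+ b₂ :* d₂ :+ b₃ :* d₃ :+ b₀ :* d₀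
          := con false) refl
        (B x) (B y) (B z) (B 0#) (D x) (D y) (D z) (D 0#)

    Δ³-monomial : ∀ c {d} → PowerOfTwoSum 2 d → ∀ x y z → Δ³ (λ t → c * t ^ d) x y z ≡ 0#
    Δ³-monomial c []                  = Δ³-const (c * 1#)
    Δ³-monomial c (_∷_ {d = d} i ds) x y z =
      trans (Δ³-cong split x y z)
            (Δ³-product (*-affine c (^-affine ds)) (additive⇒affine (frobenius-+ i)) x y z)
      where
      split : ∀ t → c * t ^ (d ℕ.+ 2 ℕ.^ i) ≡ c * t ^ d * t ^ (2 ℕ.^ i)
      split t = trans (cong (c *_) (^-+ t d _)) (sym (*-assoc _ _ _))

    Δ³-evalPoly : ∀ p → All (λ m → binaryWeight (proj₂ m) ℕ.≤ 2) p → ∀ x y z → Δ³ (evalPoly p) x y z ≡ 0#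
    Δ³-evalPoly []            []       = Δ³-const 0#
    Δ³-evalPoly ((c , d) ∷ p) (w ∷ ws) x y z = begin
      Δ³ (evalPoly ((c , d) ∷ p)) x y z                     ≡⟨ Δ³-+ (λ t → c * t ^ d) (evalPoly p) x y z ⟩
      Δ³ (λ t → c * t ^ d) x y z + Δ³ (evalPoly p) x y z    ≡⟨ cong₂ _+_ (Δ³-monomial c (binaryWeight⇒PowerOfTwoSum {d} w) x y z)
                                                                          (Δ³-evalPoly p ws x y z) ⟩
      0# + 0#                                               ≡⟨ +-identityʳ 0# ⟩
      0#                                                    ∎
      where open ≡-Reasoning

    Δ³-quadratic : ∀ {f} → Quadratic f → ∀ x y z → Δ³ f x y z ≡ 0#
    Δ³-quadratic (p , weights , f≗p) x y z = trans (Δ³-cong f≗p x y z) (Δ³-evalPoly p weights x y z)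

    c-additiveʳ : ∀ {f} → (∀ x y z → Δ³ f x y z ≡ 0#) → f 0# ≡ 0# →
                  ∀ {u} → InH u → ∀ v w → c f u (v ⊕ w) ≡ c f u v + c f u w
    c-additiveʳ {f} Δ³f≡0 f0≡0 {s , false} refl (y , a) (z , b) = begin
      P (y + z) + S (a xor b)      ≡⟨ cong₂ _+_ P-additive (S-additive a b) ⟩
      (P y + P z) + (S a + S b)    ≡⟨ solve 4 (λ p q r t → (p :+ q) :+ (r :+ t) := (p :+ r) :+ (q :+ t)) refl
                                              (P y) (P z) (S a) (S b) ⟩
      (P y + S a) + (P z + S b)    ∎
      where
      open ≡-Reasoning
      P : Carrier → Carrier
      P y = f (s + y) + f s + f y
      S : Bool → Carrier
      S a = f (0# + a · s)
      P-additive : P (y + z) ≡ P y + P z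
      P-additive = +≡0⇒≡ (begin
        P (y + z) + (P y + P z)                                                       ≡⟨ solve 7
          (λ a b c d s y z → (a :+ s :+ d) :+ ((b :+ s :+ y) :+ (c :+ s :+ z)) := a :+ b :+ c :+ d :+ s :+ y :+ z :+ con false)
          refl (f (s + (y + z))) (f (s + y)) (f (s + z)) (f (y + z)) (f s) (f y) (f z) ⟩
        f (s + (y + z)) + f (s + y) + f (s + z) + f (y + z) + f s + f y + f z + 0#    ≡⟨ cong (_ +_) (sym f0≡0) ⟩
        Δ³ f s y z                                                                    ≡⟨ Δ³f≡0 s y z ⟩
        0#                                                                            ∎)
      f[0+0]≡0 : f (0# + 0#) ≡ 0#
      f[0+0]≡0 = trans (cong f (+-identityˡ 0#)) f0≡0
      S-additive : ∀ a b → S (a xor b) ≡ S a + S b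
      S-additive false false rewrite f[0+0]≡0 = sym (+-identityʳ 0#)
      S-additive false true  rewrite f[0+0]≡0 = sym (+-identityˡ _)
      S-additive true  false rewrite f[0+0]≡0 = sym (+-identityʳ _)
      S-additive true  true  rewrite f[0+0]≡0 = sym (x+x≡0 _)

    c-kernel : ∀ {f} → Crooked f → ∀ {s} → s ≢ 0# → ∀ v →
               c f (s , false) v ≡ 0# → v ≡ (0# , false) ⊎ v ≡ (s , false)
    c-kernel {f} crooked {s} s≢0 (z , false) c≡0 with z ≟ 0# | z ≟ s
    ... | yes refl | _        = inj₁ refl
    ... | no _     | yes refl = inj₂ refl
    ... | no z≢0   | no z≢s   = ⊥-elim (three s z 0# (z≢s ∘ sym) s≢0 z≢0 (begin
      f s + f z + f 0# + f (s + z + 0#)  ≡⟨ cong₂ (λ a b → f s + f z + a + b) f0 (cong f (+-identityʳ (s + z))) ⟩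
      f s + f z + 0# + f (s + z)         ≡⟨ solve 3 (λ a b w → a :+ b :+ con false :+ w := w :+ a :+ b :+ con false)
                                                    refl (f s) (f z) (f (s + z)) ⟩
      f (s + z) + f s + f z + 0#         ≡⟨ cong (f (s + z) + f s + f z +_) (sym (trans (cong f (+-identityˡ 0#)) f0)) ⟩
      c f (s , false) (z , false)        ≡⟨ c≡0 ⟩
      0#                                 ∎))
      where
      open Crooked crooked
      open ≡-Reasoning
    c-kernel {f} crooked {s} s≢0 (z , true) c≡0 = ⊥-elim (six s s≢0 z z z (begin
      f z + f z + f z + f (z + s) + f (z + s) + f (z + s)  ≡⟨ solve 3 (λ a w t → a :+ a :+ a :+ w :+ w :+ w := w :+ t :+ a :+ t)
                                                                      refl (f z) (f (z + s)) (f s) ⟩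
      f (z + s) + f s + f z + f s                          ≡⟨ cong₂ (λ a b → f a + f s + f z + b) (+-comm z s)
                                                                        (cong f (sym (+-identityˡ s))) ⟩
      c f (s , false) (z , true)                           ≡⟨ c≡0 ⟩
      0#                                                   ∎))
      where
      open Crooked crooked
      open ≡-Reasoning

    c-not-additive : ∀ {f} → Crooked f → ∀ x {y z} → y ≢ 0# → z ≢ 0# → y ≢ z →
                     c f (x , true) ((y , false) ⊕ (z , false)) ≢ c f (x , true) (y , false) + c f (x , true) (z , false)
    c-not-additive {f} crooked x {y} {z} y≢0 z≢0 y≢z additive = three (x + y) (x + z) x
      (y≢z ∘ +-cancelˡ x y z) (y≢0 ∘ x+w≡x⇒w≡0) (z≢0 ∘ x+w≡x⇒w≡0) (begin
      f (x + y) + f (x + z) + f x + f (x + y + (x + z) + x)  ≡⟨ cong (λ t → f (x + y) + f (x + z) + f x + f t)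
                                                                 (solve 3 (λ x y z → x :+ y :+ (x :+ z) :+ x := x :+ (y :+ z)) refl x y z) ⟩
      f (x + y) + f (x + z) + f x + f (x + (y + z))          ≡⟨ solve 7 (λ a X d Y Z u v →
                                                                   u :+ v :+ X :+ a := (a :+ X :+ d :+ d) :+ ((u :+ X :+ Y :+ Y) :+ (v :+ X :+ Z :+ Z)))
                                                                 refl (f (x + (y + z))) (f x) (f (y + z)) (f y) (f z) (f (x + y)) (f (x + z)) ⟩
      (f (x + (y + z)) + f x + f (y + z) + f (y + z))
        + ((f (x + y) + f x + f y + f y) + (f (x + z) + f x + f z + f z))
                                                             ≡⟨ cong₂ _+_ (cong (f (x + (y + z)) + f x + f (y + z) +_) (f[w+0]≡f[w] (y + z)))
                                                                          (cong₂ _+_ (cong (f (x + y) + f x + f y +_) (f[w+0]≡f[w] y))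
                                                                                     (cong (f (x + z) + f x + f z +_) (f[w+0]≡f[w] z))) ⟩
      c f (x , true) (y + z , false) + (c f (x , true) (y , false) + c f (x , true) (z , false))
                                                             ≡⟨ ≡⇒+≡0 additive ⟩
      0#                                                     ∎)
      where
      open Crooked crooked
      open ≡-Reasoning
      x+w≡x⇒w≡0 : ∀ {w} → x + w ≡ x → w ≡ 0#
      x+w≡x⇒w≡0 {w} x+w≡x = +-cancelˡ x w 0# (trans x+w≡x (sym (+-identityʳ x)))
      f[w+0]≡f[w] : ∀ w → f w ≡ f (w + 0#)
      f[w+0]≡f[w] w = cong f (sym (+-identityʳ w))

    -- χ separates y from y + s, so by c-kernel the map ψ is injective.
    c-surjective : ∀ {f} → Quadratic f → Crooked f → ∀ {s} → s ≢ 0# → ∀ t → ∃ λ v → c f (s , false) v ≡ t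
    c-surjective {f} quadratic crooked {s} s≢0 t =
      let y , ψy≡t = injective⇒surjective ψ ψ-injective t in (y , χ y) , ψy≡t
      where
      ι : Carrier → Carrier
      ι y = y + s
      ι-involutive : ∀ y → ι (ι y) ≡ y
      ι-involutive y = solve 2 (λ y s → y :+ s :+ s := y) refl y s
      ι-fixedPointFree : ∀ y → ι y ≢ y
      ι-fixedPointFree y y+s≡y = s≢0 (+-cancelˡ y s 0# (trans y+s≡y (sym (+-identityʳ y))))
      χ : Carrier → Bool
      χ = proj₁ (involution-orientation ι ι-involutive ι-fixedPointFree)
      χ∘ι≢χ : ∀ y → χ (ι y) ≢ χ y
      χ∘ι≢χ = proj₂ (involution-orientation ι ι-involutive ι-fixedPointFree)
      ψ : Carrier → Carrier
      ψ y = c f (s , false) (y , χ y)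
      xor≡false⇒≡ : ∀ {a b} → a xor b ≡ false → a ≡ b
      xor≡false⇒≡ {false} {false} _ = refl
      xor≡false⇒≡ {true}  {true}  _ = refl
      ψ-injective : Injective _≡_ _≡_ ψ
      ψ-injective {y} {y′} ψy≡ψy′
        with c-kernel crooked s≢0 _ (trans (c-additiveʳ (Δ³-quadratic quadratic) (Crooked.f0 crooked) refl
                                              (y , χ y) (y′ , χ y′)) (≡⇒+≡0 ψy≡ψy′))
      ... | inj₁ kernel₀ = +≡0⇒≡ (cong proj₁ kernel₀)
      ... | inj₂ kernelₛ = ⊥-elim (χ∘ι≢χ y (trans (sym (cong χ y′≡ιy)) (sym (xor≡false⇒≡ (cong proj₂ kernelₛ)))))
        where
        y′≡ιy : y′ ≡ ι y
        y′≡ιy = trans (sym (x+[x+y]≡y y y′)) (cong (y +_) (cong proj₁ kernelₛ))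

    module Isomorphism (2<2^n : 2 < 2 ℕ.^ n)
      {f f′ : Carrier → Carrier} (quadratic : Quadratic f) (crooked : Crooked f)
      (quadratic′ : Quadratic f′) (crooked′ : Crooked f′)
      {σ : Carrier → Carrier} {κ : V → V} (collineation : Collineation κ)
      (iso : ∀ u v → σ (c f u v) ≡ c f′ (κ u) (κ v)) where

      open Collineation collineation
      open ≡-Reasoning

      e : Carrier
      e = proj₁ (∃≢₂ 2<2^n 0# 1#)
      e≢0 : e ≢ 0#
      e≢0 = proj₁ (proj₂ (∃≢₂ 2<2^n 0# 1#))
      e≢1 : e ≢ 1#
      e≢1 = proj₂ (proj₂ (∃≢₂ 2<2^n 0# 1#))
      1≢0 : 1# ≢ 0#
      1≢0 = 0≢1 ∘ sym

      κ-surjective : ∀ w → ∃ λ u → κ u ≡ w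
      κ-surjective = Bijection.strictlySurjective (mk⤖ bijective)

      c-additive : ∀ {u} → InH u → ∀ v w → c f u (v ⊕ w) ≡ c f u v + c f u w
      c-additive = c-additiveʳ (Δ³-quadratic quadratic) (Crooked.f0 crooked)

      c′-additive : ∀ {u} → InH u → ∀ v w → c f′ u (v ⊕ w) ≡ c f′ u v + c f′ u w
      c′-additive = c-additiveʳ (Δ³-quadratic quadratic′) (Crooked.f0 crooked′)

      c′-additive⇒InH : ∀ w → (∀ v v′ → c f′ w (v ⊕ v′) ≡ c f′ w v + c f′ w v′) → InH w
      c′-additive⇒InH (_ , false) _        = refl
      c′-additive⇒InH (x , true)  additive = ⊥-elim (c-not-additive crooked′ x 1≢0 e≢0 (e≢1 ∘ sym) (additive _ _))

      -- Among κ(1,0), κ(e,0) and their sum κ(1+e,0), one lies in H.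
      H-point-mapped-into-H : ∃ λ s → s ≢ 0# × InH (κ (s , false))
      H-point-mapped-into-H with proj₂ (κ (1# , false)) in κ₁∈H | proj₂ (κ (e , false)) in κₑ∈H
      ... | false | _     = 1# , 1≢0 , κ₁∈H
      ... | true  | false = e , e≢0 , κₑ∈H
      ... | true  | true  = 1# + e , e≢1 ∘ sym ∘ +≡0⇒≡ ,
                            trans (cong proj₂ (additive (1# , false) (e , false))) (cong₂ _xor_ κ₁∈H κₑ∈H)

      σ-additive : ∀ a b → σ (a + b) ≡ σ a + σ b
      σ-additive a b = begin
        σ (a + b)                            ≡⟨ cong σ (sym (cong₂ _+_ cv≡a cw≡b)) ⟩
        σ (c f u v + c f u w)                ≡⟨ cong σ (sym (c-additive refl v w)) ⟩
        σ (c f u (v ⊕ w))                    ≡⟨ iso u (v ⊕ w) ⟩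
        c f′ (κ u) (κ (v ⊕ w))               ≡⟨ cong (c f′ (κ u)) (additive v w) ⟩
        c f′ (κ u) (κ v ⊕ κ w)               ≡⟨ c′-additive κu∈H (κ v) (κ w) ⟩
        c f′ (κ u) (κ v) + c f′ (κ u) (κ w)  ≡⟨ sym (cong₂ _+_ (iso u v) (iso u w)) ⟩
        σ (c f u v) + σ (c f u w)            ≡⟨ cong₂ _+_ (cong σ cv≡a) (cong σ cw≡b) ⟩
        σ a + σ b                            ∎
        where
        s = proj₁ H-point-mapped-into-H
        u = (s , false)
        κu∈H = proj₂ (proj₂ H-point-mapped-into-H)
        c-onto = c-surjective quadratic crooked (proj₁ (proj₂ H-point-mapped-into-H))
        v = proj₁ (c-onto a)
        cv≡a = proj₂ (c-onto a)
        w = proj₁ (c-onto b)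
        cw≡b = proj₂ (c-onto b)

      c′-additive-at-κ : ∀ {u} → InH u → ∀ v w → c f′ (κ u) (v ⊕ w) ≡ c f′ (κ u) v + c f′ (κ u) w
      c′-additive-at-κ {u} u∈H v w = begin
        c f′ (κ u) (v ⊕ w)                     ≡⟨ cong (c f′ (κ u)) (sym (cong₂ _⊕_ κv′≡v κw′≡w)) ⟩
        c f′ (κ u) (κ v′ ⊕ κ w′)               ≡⟨ cong (c f′ (κ u)) (sym (additive v′ w′)) ⟩
        c f′ (κ u) (κ (v′ ⊕ w′))               ≡⟨ sym (iso u (v′ ⊕ w′)) ⟩
        σ (c f u (v′ ⊕ w′))                    ≡⟨ cong σ (c-additive u∈H v′ w′) ⟩
        σ (c f u v′ + c f u w′)                ≡⟨ σ-additive _ _ ⟩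
        σ (c f u v′) + σ (c f u w′)            ≡⟨ cong₂ _+_ (iso u v′) (iso u w′) ⟩
        c f′ (κ u) (κ v′) + c f′ (κ u) (κ w′)  ≡⟨ cong₂ _+_ (cong (c f′ (κ u)) κv′≡v) (cong (c f′ (κ u)) κw′≡w) ⟩
        c f′ (κ u) v + c f′ (κ u) w            ∎
        where
        v′ = proj₁ (κ-surjective v)
        κv′≡v = proj₂ (κ-surjective v)
        w′ = proj₁ (κ-surjective w)
        κw′≡w = proj₂ (κ-surjective w)

      κ-preserves-H : ∀ u → InH u → InH (κ u)
      κ-preserves-H u u∈H = c′-additive⇒InH (κ u) (c′-additive-at-κ u∈H)

  module InverseIsomorphism {f f′ : Carrier → Carrier} {σ : Carrier → Carrier} {κ : V → V}
    (σ-bijective : Bijective _≡_ _≡_ σ) (collineation : Collineation κ)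
    (iso : ∀ u v → σ (c f u v) ≡ c f′ (κ u) (κ v)) where

    open Collineation collineation

    κ↔ : V ↔ V
    κ↔ = ⤖⇒↔ (mk⤖ bijective)

    σ↔ : Carrier ↔ Carrier
    σ↔ = ⤖⇒↔ (mk⤖ σ-bijective)

    κ⁻¹ : V → V
    κ⁻¹ = Inverse.from κ↔

    σ⁻¹ : Carrier → Carrier
    σ⁻¹ = Inverse.from σ↔

    κ∘κ⁻¹ : ∀ w → κ (κ⁻¹ w) ≡ w
    κ∘κ⁻¹ = Inverse.strictlyInverseˡ κ↔

    collineation⁻¹ : Collineation κ⁻¹
    collineation⁻¹ = record
      { additive  = λ u v → begin
          κ⁻¹ (u ⊕ v)                      ≡⟨ cong κ⁻¹ (sym (cong₂ _⊕_ (κ∘κ⁻¹ u) (κ∘κ⁻¹ v))) ⟩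
          κ⁻¹ (κ (κ⁻¹ u) ⊕ κ (κ⁻¹ v))      ≡⟨ cong κ⁻¹ (sym (additive (κ⁻¹ u) (κ⁻¹ v))) ⟩
          κ⁻¹ (κ (κ⁻¹ u ⊕ κ⁻¹ v))          ≡⟨ Inverse.strictlyInverseʳ κ↔ _ ⟩
          κ⁻¹ u ⊕ κ⁻¹ v                    ∎
      ; bijective = Bijection.bijective (↔⇒⤖ (↔-sym κ↔))
      }
      where open ≡-Reasoning

    iso⁻¹ : ∀ u v → σ⁻¹ (c f′ u v) ≡ c f (κ⁻¹ u) (κ⁻¹ v)
    iso⁻¹ u v = proj₁ σ-bijective (begin
      σ (σ⁻¹ (c f′ u v))              ≡⟨ Inverse.strictlyInverseˡ σ↔ _ ⟩
      c f′ u v                        ≡⟨ sym (cong₂ (c f′) (κ∘κ⁻¹ u) (κ∘κ⁻¹ v)) ⟩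
      c f′ (κ (κ⁻¹ u)) (κ (κ⁻¹ v))    ≡⟨ sym (iso (κ⁻¹ u) (κ⁻¹ v)) ⟩
      σ (c f (κ⁻¹ u) (κ⁻¹ v))         ∎)
      where open ≡-Reasoning

lemma9 : (n : ℕ) → 3 < n → (F : GF2^ n) →
    let open GF2^ F in
    (f f' : Carrier → Carrier) → Quadratic f → Crooked f → Quadratic f' → Crooked f' →
    (σ : Carrier → Carrier) → Bijective _≡_ _≡_ σ → σ 0# ≡ 0# →
    (κ : V → V) → Collineation κ →
    (∀ u v → σ (c f u v) ≡ c f' (κ u) (κ v)) →
    (∀ u → InH u → InH (κ u)) × (∀ w → InH w → ∃ λ u → InH u × κ u ≡ w)
lemma9 n 3<n F f f′ quadratic crooked quadratic′ crooked′ σ σ-bijective _ κ collineation iso =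
  κ-preserves-H , λ w w∈H → κ⁻¹ w , κ⁻¹-preserves-H w w∈H , κ∘κ⁻¹ w
  where
  open import Data.Nat.Base as ℕ using (z≤n; s≤s; >-nonZero)
  open import Data.Nat.Properties using (≤-trans; ^-monoʳ-<)
  open Field F
  open InverseIsomorphism {f} {f′} σ-bijective collineation iso
  1<n : 1 < n
  1<n = ≤-trans (s≤s (s≤s z≤n)) 3<n
  open Characteristic2 (characteristic-two {{>-nonZero (≤-trans (s≤s z≤n) 1<n)}})
  2<2^n : 2 < 2 ℕ.^ n
  2<2^n = ^-monoʳ-< 2 (s≤s (s≤s z≤n)) 1<n
  open Isomorphism 2<2^n quadratic crooked quadratic′ crooked′ {σ} collineation iso
    using (κ-preserves-H)
  open Isomorphism 2<2^n quadratic′ crooked′ quadratic crooked {σ⁻¹} collineation⁻¹ iso⁻¹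
    using () renaming (κ-preserves-H to κ⁻¹-preserves-H)
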